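{- Let $G_1,\ldots,G_k$ be graphs such that for every $i=2,\ldots,k$, $G_1$ contains a subgraph isomorphic to $G_i$. Let $\bigcup_{i=1}^k G_i$ denote their vertex-disjoint union. Then $N(\bigcup_{i=1}^k G_i)\leq N(G_1)+k$.
   Context: For a graph $G$, a covering of $G$ is a collection of subsets $A_1,\ldots,A_n$ of $V(G)$ such that for every edge $\{u,v\}$ and every vertex $x\notin\{u,v\}$ there is some $A_j$ with $\{u,v\}\subseteq A_j$ and $x\notin A_j$; $N(G)$ is the minimum size of a covering of $G$. -}

module Defs where

open import Data.Nat using (ℕ; _≤_)
open import Data.Bool using (Bool; true; false)
open import Data.Fin using (Fin)
open import Data.List using (List; length)
open import Data.List.Relation.Unary.Any using (Any)
open import Data.Product using (Σ; ∃; _×_; _,_)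
open import Relation.Binary.PropositionalEquality using (_≡_; _≢_)
open import Relation.Nullary using (¬_)
open import Function.Bundles using (_↔_)
open import Function.Definitions using (Injective)

record Graph : Set₁ where
  field
    V     : Set
    Adj   : V → V → Set
    sym   : ∀ {u v} → Adj u v → Adj v u
    irrefl : ∀ {u} → ¬ Adj u u
open Graph public

Finite : Graph → Set
Finite G = Σ ℕ (λ m → V G ↔ Fin m)

VSubset : Graph → Set
VSubset G = V G → Bool

IsCovering : (G : Graph) → List (VSubset G) → Set
IsCovering G C =
  ∀ u v → Adj G u v → ∀ x → x ≢ u → x ≢ v →
    Any (λ A → (A u ≡ true) × (A v ≡ true) × (A x ≡ false)) C

HasCoveringOfSize : Graph → ℕ → Set
HasCoveringOfSize G n = Σ (List (VSubset G)) (λ C → IsCovering G C × length C ≡ n)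

IsN : Graph → ℕ → Set
IsN G n = HasCoveringOfSize G n × (∀ m → HasCoveringOfSize G m → n ≤ m)

SubgraphIso : Graph → Graph → Set
SubgraphIso H G =
  Σ (V H → V G) (λ f → Injective _≡_ _≡_ f × (∀ u v → Adj H u v → Adj G (f u) (f v)))

⋃ : {k : ℕ} → (Fin k → Graph) → Graph
⋃ {k} G = record
  { V = Σ (Fin k) (λ i → V (G i))
  ; Adj = λ { (i , u) (j , v) → Σ (i ≡ j) (λ { Relation.Binary.PropositionalEquality.refl → Adj (G i) u v }) }
  ; sym = λ { {i , u} {.i , v} (Relation.Binary.PropositionalEquality.refl , a) → Relation.Binary.PropositionalEquality.refl , sym (G i) a }
  ; irrefl = λ { {i , u} (Relation.Binary.PropositionalEquality.refl , a) → irrefl (G i) a }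
  }

-- Pull a minimum covering of G₁ back to every component along its embedding
-- into G₁: these sets separate an edge from every vertex of its own component,
-- by injectivity of the embedding.  The k + 1 indicator sets of the components
-- separate an edge from every vertex of another component.
module Submission where

open import Defs
open import Data.Nat using (ℕ; suc; _+_; _≤_)
open import Data.Fin using (Fin; zero; _≟_)
open import Data.Bool using (true; false)
open import Data.List using (List; map; tabulate; _++_; length)
open import Data.List.Relation.Unary.Any using (Any)
open import Data.List.Relation.Unary.Any.Properties using (map⁺; tabulate⁺; ++⁺ˡ; ++⁺ʳ)
open import Data.List.Properties using (length-++; length-map; length-tabulate)
open import Data.Product using (_×_; _,_; proj₁; proj₂)
open import Function using (_∘_)
open import Relation.Nullary using (yes; no)
open import Relation.Nullary.Decidable using (does; dec-true; dec-false)
open import Relation.Binary.PropositionalEquality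

Separates : (G : Graph) → List (VSubset G) → V G → V G → V G → Set
Separates G C u v x = Any (λ A → (A u ≡ true) × (A v ≡ true) × (A x ≡ false)) C

separates-pullback : (G H : Graph) (g : V H → V G) (C : List (VSubset G)) {u v x : V H} →
  Separates G C (g u) (g v) (g x) → Separates H (map (_∘ g) C) u v x
separates-pullback _ _ _ _ = map⁺

module _ {k : ℕ} (G : Fin k → Graph) where

  inComponent : Fin k → VSubset (⋃ G)
  inComponent j (i , _) = does (i ≟ j)

  components-separate : ∀ {i j} u v w → j ≢ i →
    Separates (⋃ G) (tabulate inComponent) (i , u) (i , v) (j , w)
  components-separate {i} {j} _ _ _ j≢i = tabulate⁺ i
    (dec-true (i ≟ i) refl , dec-true (i ≟ i) refl , dec-false (j ≟ i) j≢i)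

  module _ (H : Graph) (emb : ∀ i → SubgraphIso (G i) H) where

    collapse : V (⋃ G) → V H
    collapse (i , u) = proj₁ (emb i) u

    ⋃-cover : List (VSubset H) → List (VSubset (⋃ G))
    ⋃-cover C = map (_∘ collapse) C ++ tabulate inComponent

    ⋃-covering : ∀ C → IsCovering H C → IsCovering (⋃ G) (⋃-cover C)
    ⋃-covering C cov (i , u) (.i , v) (refl , uv) (j , w) w≢u w≢v with j ≟ i
    ... | no j≢i = ++⁺ʳ (map (_∘ collapse) C) (components-separate u v w j≢i)
    ... | yes refl = ++⁺ˡ (separates-pullback H (⋃ G) collapse C
          (cov (f u) (f v) (f-edge u v uv) (f w) (w≢u ∘ f-inj) (w≢v ∘ f-inj)))
      where
        f = proj₁ (emb i)
        f-inj : ∀ {x y} → f x ≡ f y → (i , x) ≡ (i , y)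
        f-inj = cong (i ,_) ∘ proj₁ (proj₂ (emb i))
        f-edge = proj₂ (proj₂ (emb i))

    length-⋃-cover : ∀ C → length (⋃-cover C) ≡ length C + k
    length-⋃-cover C = begin
      length (⋃-cover C)
        ≡⟨ length-++ (map (_∘ collapse) C) ⟩
      length (map (_∘ collapse) C) + length (tabulate inComponent)
        ≡⟨ cong₂ _+_ (length-map (_∘ collapse) C) (length-tabulate inComponent) ⟩
      length C + k ∎
      where open ≡-Reasoning

lemma3p7 : (k : ℕ) (G : Fin (suc k) → Graph) → (∀ i → Finite (G i)) →
    (∀ i → SubgraphIso (G i) (G zero)) →
    ∀ n m → IsN (G zero) n → IsN (⋃ G) m → m ≤ n + suc k
lemma3p7 k G _ emb n m ((C , covers , refl) , _) (_ , minimal) =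
  minimal (length C + suc k)
    (_ , ⋃-covering G (G zero) emb C covers , length-⋃-cover G (G zero) emb C)
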